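{- Exhaustive subsumption is symmetry-preserving: for all CNF formulas $F$ and $F^*$ such that $F^*$ is obtained from $F$ by applying the subsumption rule until it is no longer applicable, we have $\mathrm{Aut}_{\mathrm{syn}}(F)_{\{\mathrm{Lit}(F^*)\}}=\mathrm{Aut}_{\mathrm{syn}}(F)$ and $\mathrm{Aut}_{\mathrm{syn}}(F)\downarrow_{\mathrm{Lit}(F^*)}\subseteq\mathrm{Aut}_{\mathrm{syn}}(F^*)$.
   Context: Literals: each variable $v$ gives literals $v,\bar v$ with $\bar{\bar v}=v$. A CNF formula $F$ is a finite set of clauses, each a finite set of literals; $\mathrm{Var}(F)$ is the set of variables occurring in $F$, $\mathrm{Lit}(F):=\mathrm{Var}(F)\cup\{\bar v:v\in\mathrm{Var}(F)\}$. Bijections of literals act elementwise on clauses and formulas. A syntactic symmetry of $F$ is a bijection $\varphi:\mathrm{Lit}(F)\to\mathrm{Lit}(F)$ with $\varphi(F)=F$ and $\overline{\varphi(l)}=\varphi(\bar l)$ for all $l$; these form the group $\mathrm{Aut}_{\mathrm{syn}}(F)$. For a permutation group $\Gamma$ on $\Omega$ and $\Omega'\subseteq\Omega$: $\Gamma_{\{\Omega'\}}:=\{\varphi\in\Gamma:\varphi(\Omega')=\Omega'\}$ and $\Gamma\downarrow_{\Omega'}:=\{\varphi|_{\Omega'}:\varphi\in\Gamma_{\{\Omega'\}}\}$. The subsumption rule transforms a formula $F$ containing clauses $C,D\in F$ with $C\subsetneq D$ into $F\setminus\{D\}$. -}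

module Defs where

open import Data.Nat using (ℕ)
open import Data.List using (List; map)
open import Data.List.Membership.Propositional using (_∈_)
open import Data.Product using (Σ; ∃; _×_; _,_)
open import Relation.Nullary using (¬_)
open import Relation.Binary.PropositionalEquality using (_≡_)
open import Relation.Binary.Construct.Closure.ReflexiveTransitive using (Star)

data Lit : Set where
  pos : ℕ → Lit
  neg : ℕ → Lit

‾_ : Lit → Lit
‾ pos v = neg v
‾ neg v = pos v

var : Lit → ℕ
var (pos v) = v
var (neg v) = v

-- A clause is a finite set of literals, represented by a list
-- (order and repetitions irrelevant); a formula is a finite set of clauses,
-- represented by a list of clauses (again read as a set, clauses up to
-- set-equality).
Clause : Set
Clause = List Lit

Formula : Set
Formula = List Clause

_⊆ᶜ_ : Clause → Clause → Set
C ⊆ᶜ D = ∀ l → l ∈ C → l ∈ D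

_≐_ : Clause → Clause → Set
C ≐ D = (C ⊆ᶜ D) × (D ⊆ᶜ C)

_⊊ᶜ_ : Clause → Clause → Set
C ⊊ᶜ D = (C ⊆ᶜ D) × ¬ (D ⊆ᶜ C)

_∈F_ : Clause → Formula → Set
C ∈F F = ∃ λ D → (D ∈ F) × (C ≐ D)

_≋_ : Formula → Formula → Set
F ≋ G = (∀ C → C ∈F F → C ∈F G) × (∀ C → C ∈F G → C ∈F F)

InVar : Formula → ℕ → Set
InVar F v = ∃ λ C → (C ∈ F) × (∃ λ l → (l ∈ C) × (var l ≡ v))

InLit : Formula → Lit → Set
InLit F l = InVar F (var l)

_·_ : (Lit → Lit) → Clause → Clause
φ · C = map φ C

-- The map φ : Lit → Lit is only relevant on
-- Lit(F); the conditions say that its restriction to Lit(F) is a bijection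
-- Lit(F) → Lit(F), commutes with complementation, and satisfies φ(F) = F.
record IsSynSym (F : Formula) (φ : Lit → Lit) : Set where
  field
    into      : ∀ l → InLit F l → InLit F (φ l)
    injective : ∀ l l′ → InLit F l → InLit F l′ → φ l ≡ φ l′ → l ≡ l′
    onto      : ∀ l → InLit F l → ∃ λ l′ → InLit F l′ × (φ l′ ≡ l)
    compl     : ∀ l → InLit F l → ‾ (φ l) ≡ φ (‾ l)
    image⊆    : ∀ C → C ∈ F → (φ · C) ∈F F
    image⊇    : ∀ D → D ∈ F → ∃ λ C → (C ∈ F) × ((φ · C) ≐ D)

StabilisesLit : Formula → (Lit → Lit) → Set
StabilisesLit G φ =
  (∀ l → InLit G l → InLit G (φ l)) ×
  (∀ l → InLit G l → ∃ λ l′ → InLit G l′ × (φ l′ ≡ l))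

-- One application of the subsumption rule: C, D ∈ F with C ⊊ D,
-- and G = F \ {D} (as sets of clauses).
_⟶_ : Formula → Formula → Set
F ⟶ G = ∃ λ C → ∃ λ D → (C ∈F F) × (D ∈F F) × (C ⊊ᶜ D) ×
          (∀ E → E ∈F G → (E ∈F F) × ¬ (E ≐ D)) ×
          (∀ E → E ∈F F → ¬ (E ≐ D) → E ∈F G)

SubsumptionFree : Formula → Set
SubsumptionFree G = ¬ (∃ λ C → ∃ λ D → (C ∈F G) × (D ∈F G) × (C ⊊ᶜ D))

ExhaustiveSubsumption : Formula → Formula → Set
ExhaustiveSubsumption F F* = Star _⟶_ F F* × SubsumptionFree F*

module Submission where

-- The clauses of F* are exactly the inclusion-minimal clauses of F: a
-- subsumption step deletes only a clause with a proper subclause, every clause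
-- of F keeps a subclause through the reduction, and in the subsumption-free F*
-- no non-minimal clause survives.  A symmetry φ of F is injective on Lit(F), so
-- on clauses of F it both preserves and reflects proper inclusion; hence it
-- permutes the minimal clauses, i.e. the clauses of F*.  A symmetry of F that
-- permutes the clauses of a subformula is a symmetry of that subformula.

open import Defs
open import Data.Product using (_×_; _,_; proj₁; proj₂; ∃)
open import Data.Sum using (_⊎_; inj₁; inj₂)
open import Data.List.Membership.Propositional using (_∈_)
open import Data.List.Membership.Propositional.Properties using (∈-map⁺; ∈-map⁻)
import Data.List.Relation.Binary.Subset.Propositional.Properties as Subset
open import Relation.Nullary using (¬_)
open import Relation.Binary.PropositionalEquality using (_≡_; refl; sym; trans; cong; subst)
open import Relation.Binary.Construct.Closure.ReflexiveTransitive using (Star; ε; _◅_)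

⊆ᶜ-refl : ∀ {C} → C ⊆ᶜ C
⊆ᶜ-refl _ l∈C = l∈C

⊆ᶜ-trans : ∀ {A B C} → A ⊆ᶜ B → B ⊆ᶜ C → A ⊆ᶜ C
⊆ᶜ-trans A⊆B B⊆C l l∈A = B⊆C l (A⊆B l l∈A)

≐-refl : ∀ {C} → C ≐ C
≐-refl = ⊆ᶜ-refl , ⊆ᶜ-refl

≐-sym : ∀ {C D} → C ≐ D → D ≐ C
≐-sym (C⊆D , D⊆C) = D⊆C , C⊆D

≐-trans : ∀ {A B C} → A ≐ B → B ≐ C → A ≐ C
≐-trans (A⊆B , B⊆A) (B⊆C , C⊆B) = ⊆ᶜ-trans A⊆B B⊆C , ⊆ᶜ-trans C⊆B B⊆A

⊆ᶜ-⊊ᶜ-trans : ∀ {A B C} → A ⊆ᶜ B → B ⊊ᶜ C → A ⊊ᶜ C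
⊆ᶜ-⊊ᶜ-trans A⊆B (B⊆C , C⊈B) = ⊆ᶜ-trans A⊆B B⊆C , λ C⊆A → C⊈B (⊆ᶜ-trans C⊆A A⊆B)

⊊ᶜ-resp-≐ : ∀ {A A′ B B′} → A ≐ A′ → B ≐ B′ → A ⊊ᶜ B → A′ ⊊ᶜ B′
⊊ᶜ-resp-≐ (A⊆A′ , A′⊆A) (B⊆B′ , B′⊆B) (A⊆B , B⊈A) =
  ⊆ᶜ-trans A′⊆A (⊆ᶜ-trans A⊆B B⊆B′) , λ B′⊆A′ → B⊈A (⊆ᶜ-trans B⊆B′ (⊆ᶜ-trans B′⊆A′ A′⊆A))

∈⇒∈F : ∀ {F C} → C ∈ F → C ∈F F
∈⇒∈F C∈F = _ , C∈F , ≐-refl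

∈F-resp-≐ : ∀ {F C D} → C ≐ D → C ∈F F → D ∈F F
∈F-resp-≐ C≐D (E , E∈F , C≐E) = E , E∈F , ≐-trans (≐-sym C≐D) C≐E

∈F⇒InLit : ∀ {F C l} → C ∈F F → l ∈ C → InLit F l
∈F⇒InLit (D , D∈F , (C⊆D , _)) l∈C = D , D∈F , _ , C⊆D _ l∈C , refl

_⊆F_ : Formula → Formula → Set
G ⊆F F = ∀ E → E ∈F G → E ∈F F

InLit-mono : ∀ {G F} l → G ⊆F F → InLit G l → InLit F l
InLit-mono l G⊆F (C , C∈G , m , m∈C , eq) with G⊆F C (∈⇒∈F C∈G)
... | D , D∈F , (C⊆D , _) = D , D∈F , m , C⊆D m m∈C , eq

var-‾ : ∀ l → var (‾ l) ≡ var l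
var-‾ (pos v) = refl
var-‾ (neg v) = refl

InLit-‾ : ∀ {F} l → InLit F l → InLit F (‾ l)
InLit-‾ l (C , C∈F , m , m∈C , eq) = C , C∈F , m , m∈C , trans eq (sym (var-‾ l))

var-≡⇒≡⊎≡‾ : ∀ l m → var l ≡ var m → l ≡ m ⊎ l ≡ ‾ m
var-≡⇒≡⊎≡‾ (pos v) (pos .v) refl = inj₁ refl
var-≡⇒≡⊎≡‾ (pos v) (neg .v) refl = inj₂ refl
var-≡⇒≡⊎≡‾ (neg v) (pos .v) refl = inj₂ refl
var-≡⇒≡⊎≡‾ (neg v) (neg .v) refl = inj₁ refl

·-mono-⊆ᶜ : ∀ φ {C D} → C ⊆ᶜ D → (φ · C) ⊆ᶜ (φ · D)
·-mono-⊆ᶜ φ C⊆D _ = Subset.map⁺ φ (C⊆D _)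

·-cong-≐ : ∀ φ {C D} → C ≐ D → (φ · C) ≐ (φ · D)
·-cong-≐ φ (C⊆D , D⊆C) = ·-mono-⊆ᶜ φ C⊆D , ·-mono-⊆ᶜ φ D⊆C

Minimal : Formula → Clause → Set
Minimal F E = E ∈F F × (∀ C → C ∈F F → ¬ (C ⊊ᶜ E))

⟶*-⊆F : ∀ {F G} → Star _⟶_ F G → G ⊆F F
⟶*-⊆F ε E E∈G = E∈G
⟶*-⊆F ((_ , _ , _ , _ , _ , G⊆F , _) ◅ H⟶*G) E E∈G = proj₁ (G⊆F E (⟶*-⊆F H⟶*G E E∈G))

-- Only doubly negated: whether E is the deleted clause D is undecidable here.
-- This suffices, since the subclause is only ever used to refute something.
⟶-keeps-subclause : ∀ {F G E} → F ⟶ G → E ∈F F → ¬ ¬ (∃ λ C → C ∈F G × C ⊆ᶜ E)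
⟶-keeps-subclause {E = E} (C , D , C∈F , _ , (C⊆D , D⊈C) , _ , F∖D⊆G) E∈F none =
  E-deleted E-not-deleted
  where
  E-deleted : ¬ ¬ (E ≐ D)
  E-deleted E≉D = none (E , F∖D⊆G E E∈F E≉D , ⊆ᶜ-refl)
  E-not-deleted : ¬ (E ≐ D)
  E-not-deleted (_ , D⊆E) =
    none (C , F∖D⊆G C C∈F (λ C≐D → D⊈C (proj₂ C≐D)) , ⊆ᶜ-trans C⊆D D⊆E)

⟶*-keeps-subclause : ∀ {F G E} → Star _⟶_ F G → E ∈F F → ¬ ¬ (∃ λ C → C ∈F G × C ⊆ᶜ E)
⟶*-keeps-subclause ε E∈F none = none (_ , E∈F , ⊆ᶜ-refl)
⟶*-keeps-subclause (F⟶H ◅ H⟶*G) E∈F none =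
  ⟶-keeps-subclause F⟶H E∈F λ (C , C∈H , C⊆E) →
  ⟶*-keeps-subclause H⟶*G C∈H λ (C′ , C′∈G , C′⊆C) →
  none (C′ , C′∈G , ⊆ᶜ-trans C′⊆C C⊆E)

⟶*-Minimal : ∀ {F G E} → Star _⟶_ F G → Minimal F E → Minimal G E
⟶*-Minimal ε E-min = E-min
⟶*-Minimal {E = E} ((C , D , C∈F , _ , C⊊D , H⊆F , F∖D⊆H) ◅ H⟶*G) (E∈F , E-min) =
  ⟶*-Minimal H⟶*G
    ( F∖D⊆H E E∈F (λ E≐D → E-min C C∈F (⊊ᶜ-resp-≐ ≐-refl (≐-sym E≐D) C⊊D))
    , λ C′ C′∈H → E-min C′ (proj₁ (H⊆F C′ C′∈H)) )

∈F*⇒Minimal : ∀ {F F* E} → ExhaustiveSubsumption F F* → E ∈F F* → Minimal F E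
∈F*⇒Minimal (F⟶*F* , free) E∈F* =
  ⟶*-⊆F F⟶*F* _ E∈F* , λ C C∈F C⊊E →
  ⟶*-keeps-subclause F⟶*F* C∈F λ (C′ , C′∈F* , C′⊆C) →
  free (C′ , _ , C′∈F* , E∈F* , ⊆ᶜ-⊊ᶜ-trans C′⊆C C⊊E)

Minimal⇒∈F* : ∀ {F F* E} → ExhaustiveSubsumption F F* → Minimal F E → E ∈F F*
Minimal⇒∈F* (F⟶*F* , _) E-min = proj₁ (⟶*-Minimal F⟶*F* E-min)

module SynSym {F : Formula} {φ : Lit → Lit} (S : IsSynSym F φ) where
  open IsSynSym S

  ·-reflects-⊆ᶜ : ∀ {C E} → C ∈F F → E ∈F F → (φ · C) ⊆ᶜ (φ · E) → C ⊆ᶜ E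
  ·-reflects-⊆ᶜ {E = E} C∈F E∈F φC⊆φE l l∈C with ∈-map⁻ φ (φC⊆φE (φ l) (∈-map⁺ φ l∈C))
  ... | m , m∈E , φl≡φm =
    subst (_∈ E) (sym (injective l m (∈F⇒InLit C∈F l∈C) (∈F⇒InLit E∈F m∈E) φl≡φm)) m∈E

  ·-mono-⊊ᶜ : ∀ {C E} → C ∈F F → E ∈F F → C ⊊ᶜ E → (φ · C) ⊊ᶜ (φ · E)
  ·-mono-⊊ᶜ C∈F E∈F (C⊆E , E⊈C) = ·-mono-⊆ᶜ φ C⊆E , λ φE⊆φC → E⊈C (·-reflects-⊆ᶜ E∈F C∈F φE⊆φC)

  ·-reflects-⊊ᶜ : ∀ {C E} → C ∈F F → E ∈F F → (φ · C) ⊊ᶜ (φ · E) → C ⊊ᶜ E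
  ·-reflects-⊊ᶜ C∈F E∈F (φC⊆φE , φE⊈φC) = ·-reflects-⊆ᶜ C∈F E∈F φC⊆φE , λ E⊆C → φE⊈φC (·-mono-⊆ᶜ φ E⊆C)

  ·-∈F : ∀ {C} → C ∈F F → (φ · C) ∈F F
  ·-∈F (D , D∈F , C≐D) = ∈F-resp-≐ (≐-sym (·-cong-≐ φ C≐D)) (image⊆ D D∈F)

  ·-preimage : ∀ {D} → D ∈F F → ∃ λ C → C ∈ F × (φ · C) ≐ D
  ·-preimage (D′ , D′∈F , D≐D′) with image⊇ D′ D′∈F
  ... | C , C∈F , φC≐D′ = C , C∈F , ≐-trans φC≐D′ (≐-sym D≐D′)

  ·-Minimal : ∀ {E} → Minimal F E → Minimal F (φ · E)
  ·-Minimal (E∈F , E-min) = ·-∈F E∈F , λ C C∈F C⊊φE →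
    let (C′ , C′∈F , φC′≐C) = ·-preimage C∈F
    in  E-min C′ (∈⇒∈F C′∈F)
          (·-reflects-⊊ᶜ (∈⇒∈F C′∈F) E∈F (⊊ᶜ-resp-≐ (≐-sym φC′≐C) ≐-refl C⊊φE))

  ·-preimage-Minimal : ∀ {D} → Minimal F D → ∃ λ C → Minimal F C × (φ · C) ≐ D
  ·-preimage-Minimal (D∈F , D-min) with ·-preimage D∈F
  ... | C , C∈F , φC≐D = C , (∈⇒∈F C∈F , C-min) , φC≐D
    where
    C-min : ∀ C′ → C′ ∈F F → ¬ (C′ ⊊ᶜ C)
    C-min C′ C′∈F C′⊊C =
      D-min (φ · C′) (·-∈F C′∈F) (⊊ᶜ-resp-≐ ≐-refl φC≐D (·-mono-⊊ᶜ C′∈F (∈⇒∈F C∈F) C′⊊C))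

  var-φ : ∀ l m → InLit F l → var m ≡ var l → var (φ m) ≡ var (φ l)
  var-φ l m l∈F eq with var-≡⇒≡⊎≡‾ m l eq
  ... | inj₁ refl = refl
  ... | inj₂ refl = trans (cong var (sym (compl l l∈F))) (var-‾ (φ l))

  restrict : ∀ {G} → G ⊆F F →
             (∀ C → C ∈ G → (φ · C) ∈F G) →
             (∀ D → D ∈ G → ∃ λ C → C ∈ G × (φ · C) ≐ D) →
             StabilisesLit G φ × IsSynSym G φ
  restrict {G} G⊆F φG⊆G G⊆φG = (intoG , ontoG) , record
    { into      = intoG
    ; injective = λ l l′ l∈G l′∈G → injective l l′ (InLit-mono l G⊆F l∈G) (InLit-mono l′ G⊆F l′∈G)
    ; onto      = ontoG
    ; compl     = λ l l∈G → compl l (InLit-mono l G⊆F l∈G)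
    ; image⊆    = φG⊆G
    ; image⊇    = G⊆φG
    }
    where
    intoG : ∀ l → InLit G l → InLit G (φ l)
    intoG l l∈G@(C , C∈G , m , m∈C , eq) with φG⊆G C C∈G
    ... | D , D∈G , (φC⊆D , _) =
      D , D∈G , φ m , φC⊆D (φ m) (∈-map⁺ φ m∈C) , var-φ l m (InLit-mono l G⊆F l∈G) eq

    -- l shares its variable with φ m′ for some literal m′ of G, so l is φ m′ or φ (‾ m′).
    ontoG : ∀ l → InLit G l → ∃ λ l′ → InLit G l′ × φ l′ ≡ l
    ontoG l (C , C∈G , m , m∈C , eq) with G⊆φG C C∈G
    ... | C′ , C′∈G , (_ , C⊆φC′) with ∈-map⁻ φ (C⊆φC′ m m∈C) | var-≡⇒≡⊎≡‾ l m (sym eq)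
    ... | m′ , m′∈C′ , refl | inj₁ refl = m′ , m′∈G , refl
      where
      m′∈G : InLit G m′
      m′∈G = C′ , C′∈G , m′ , m′∈C′ , refl
    ... | m′ , m′∈C′ , refl | inj₂ refl = ‾ m′ , InLit-‾ m′ m′∈G , sym (compl m′ (InLit-mono m′ G⊆F m′∈G))
      where
      m′∈G : InLit G m′
      m′∈G = C′ , C′∈G , m′ , m′∈C′ , refl

lemma4 : ∀ (F F* : Formula) → ExhaustiveSubsumption F F* →
           ∀ (φ : Lit → Lit) → IsSynSym F φ →
           StabilisesLit F* φ × IsSynSym F* φ
lemma4 F F* ex φ S = restrict (⟶*-⊆F (proj₁ ex)) image preimage
  where
  open SynSym S

  image : ∀ C → C ∈ F* → (φ · C) ∈F F*
  image C C∈F* = Minimal⇒∈F* ex (·-Minimal (∈F*⇒Minimal ex (∈⇒∈F C∈F*)))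

  preimage : ∀ D → D ∈ F* → ∃ λ C → C ∈ F* × (φ · C) ≐ D
  preimage D D∈F* with ·-preimage-Minimal (∈F*⇒Minimal ex (∈⇒∈F D∈F*))
  ... | C , C-min , φC≐D with Minimal⇒∈F* ex C-min
  ... | C′ , C′∈F* , C≐C′ = C′ , C′∈F* , ≐-trans (·-cong-≐ φ (≐-sym C≐C′)) φC≐D
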